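{- For every finitely cocomplete category $\mathcal C$, $\mathsf{Cospan}^{\leq}(\mathcal C)$ is a preordered cartesian bicategory.
   Context: For a finitely cocomplete category $\mathcal C$, $\mathsf{Cospan}^{\leq}(\mathcal C)$ is the monoidal category with the objects of $\mathcal C$, arrows $X\to Y$ the isomorphism classes of cospans $X\to A\leftarrow Y$, composition given by pushout, identity $X\xrightarrow{\mathrm{id}}X\xleftarrow{\mathrm{id}}X$, monoidal product given by coproduct in $\mathcal C$ with unit the initial object $0$, and local preorder $(X\to A\leftarrow Y)\le(X\to B\leftarrow Y)$ iff there exists an arrow $B\to A$ in $\mathcal C$ commuting with the legs. A preordered cartesian bicategory is a symmetric monoidal category $(\mathcal B,\oplus,I)$ enriched over preorders (hom-sets preordered, composition and $\oplus$ monotone) such that every object $X$ has a monoid $\mu_X:X\oplus X\to X$, $\eta_X:I\to X$ and a comonoid $\delta_X:X\to X\oplus X$, $\varepsilon_X:X\to I$ forming a special commutative Frobenius bimonoid (with $;$ diagrammatic composition: (co)associativity, (co)unit and (co)commutativity laws, Frobenius law $(\delta_X\oplus\mathrm{id}_X);(\mathrm{id}_X\oplus\mu_X)=\mu_X;\delta_X=(\mathrm{id}_X\oplus\delta_X);(\mu_X\oplus\mathrm{id}_X)$, speciality $\delta_X;\mu_X=\mathrm{id}_X$); such that the monoid and comonoid are adjoint: $\mathrm{id}_X\le\varepsilon_X;\eta_X$, $\eta_X;\varepsilon_X\le\mathrm{id}_I$, $\mathrm{id}_X\le\delta_X;\mu_X$, $\mu_X;\delta_X\le\mathrm{id}_{X\oplus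 X}$; and such that every arrow $R:X\to Y$ is a lax comonoid morphism: $R;\delta_Y\le\delta_X;(R\oplus R)$ and $R;\varepsilon_Y\le\varepsilon_X$. -}

module Defs where

open import Level using (Level; _⊔_; suc)
open import Data.Product using (Σ; _×_; _,_; ∃-syntax)
open import Relation.Binary using (Rel; IsEquivalence; IsPreorder)

record Category (o ℓ e : Level) : Set (suc (o ⊔ ℓ ⊔ e)) where
  infix  4 _≈_ _⇒_
  infixr 9 _∘_
  field
    Obj : Set o
    _⇒_ : Obj → Obj → Set ℓ
    _≈_ : ∀ {A B} → Rel (A ⇒ B) e
    id  : ∀ {A} → A ⇒ A
    _∘_ : ∀ {A B C} → B ⇒ C → A ⇒ B → A ⇒ C
    equiv     : ∀ {A B} → IsEquivalence (_≈_ {A} {B})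
    ∘-resp-≈  : ∀ {A B C} {f h : B ⇒ C} {g i : A ⇒ B} →
                f ≈ h → g ≈ i → f ∘ g ≈ h ∘ i
    assoc     : ∀ {A B C D} {f : A ⇒ B} {g : B ⇒ C} {h : C ⇒ D} →
                (h ∘ g) ∘ f ≈ h ∘ (g ∘ f)
    identityˡ : ∀ {A B} {f : A ⇒ B} → id ∘ f ≈ f
    identityʳ : ∀ {A B} {f : A ⇒ B} → f ∘ id ≈ f

module _ {o ℓ e} (C : Category o ℓ e) where
  open Category C

  record Initial : Set (o ⊔ ℓ ⊔ e) where
    field
      ⊥        : Obj
      !        : ∀ {A} → ⊥ ⇒ A
      !-unique : ∀ {A} (f : ⊥ ⇒ A) → ! ≈ f

  record Coproduct (A B : Obj) : Set (o ⊔ ℓ ⊔ e) where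
    field
      A+B     : Obj
      i₁      : A ⇒ A+B
      i₂      : B ⇒ A+B
      [_,_]   : ∀ {X} → A ⇒ X → B ⇒ X → A+B ⇒ X
      inject₁ : ∀ {X} {f : A ⇒ X} {g : B ⇒ X} → [ f , g ] ∘ i₁ ≈ f
      inject₂ : ∀ {X} {f : A ⇒ X} {g : B ⇒ X} → [ f , g ] ∘ i₂ ≈ g
      unique  : ∀ {X} {h : A+B ⇒ X} {f : A ⇒ X} {g : B ⇒ X} →
                h ∘ i₁ ≈ f → h ∘ i₂ ≈ g → [ f , g ] ≈ h

  record Coequalizer {A B : Obj} (f g : A ⇒ B) : Set (o ⊔ ℓ ⊔ e) where
    field
      obj       : Obj
      arr       : B ⇒ obj
      equality  : arr ∘ f ≈ arr ∘ g
      coequalize : ∀ {X} {h : B ⇒ X} → h ∘ f ≈ h ∘ g → obj ⇒ X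
      universal : ∀ {X} {h : B ⇒ X} {eq : h ∘ f ≈ h ∘ g} →
                  h ≈ coequalize eq ∘ arr
      unique    : ∀ {X} {h : B ⇒ X} {i : obj ⇒ X} {eq : h ∘ f ≈ h ∘ g} →
                  h ≈ i ∘ arr → i ≈ coequalize eq

  record FinitelyCocomplete : Set (o ⊔ ℓ ⊔ e) where
    field
      initial     : Initial
      coproduct   : ∀ A B → Coproduct A B
      coequalizer : ∀ {A B} (f g : A ⇒ B) → Coequalizer f g

record SMCData (o ℓ e : Level) : Set (suc (o ⊔ ℓ ⊔ e)) where
  infix  4 _≈_ _≤_
  infixl 9 _⨾_
  infixr 10 _⊕_ _⊕₁_
  field
    Obj  : Set o
    Hom  : Obj → Obj → Set ℓ
    _≈_  : ∀ {X Y} → Rel (Hom X Y) e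
    _≤_  : ∀ {X Y} → Rel (Hom X Y) e
    id   : ∀ {X} → Hom X X
    _⨾_  : ∀ {X Y Z} → Hom X Y → Hom Y Z → Hom X Z
    _⊕_  : Obj → Obj → Obj
    _⊕₁_ : ∀ {X Y X′ Y′} → Hom X Y → Hom X′ Y′ → Hom (X ⊕ X′) (Y ⊕ Y′)
    I    : Obj
    α    : ∀ {X Y Z} → Hom ((X ⊕ Y) ⊕ Z) (X ⊕ (Y ⊕ Z))
    α⁻¹  : ∀ {X Y Z} → Hom (X ⊕ (Y ⊕ Z)) ((X ⊕ Y) ⊕ Z)
    λ′   : ∀ {X} → Hom (I ⊕ X) X
    λ′⁻¹ : ∀ {X} → Hom X (I ⊕ X)
    ρ    : ∀ {X} → Hom (X ⊕ I) X
    ρ⁻¹  : ∀ {X} → Hom X (X ⊕ I)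
    σ    : ∀ {X Y} → Hom (X ⊕ Y) (Y ⊕ X)

-- A special commutative Frobenius bimonoid on X (laws stated up to the
-- structural isomorphisms, since ⊕ need not be strict).
module _ {o ℓ e} (D : SMCData o ℓ e) where
  open SMCData D

  record FrobeniusBimonoid (X : Obj) : Set (ℓ ⊔ e) where
    field
      μ : Hom (X ⊕ X) X
      η : Hom I X
      δ : Hom X (X ⊕ X)
      ε : Hom X I
      μ-assoc  : (μ ⊕₁ id) ⨾ μ ≈ α ⨾ (id ⊕₁ μ) ⨾ μ
      μ-unitˡ  : (η ⊕₁ id) ⨾ μ ≈ λ′
      μ-unitʳ  : (id ⊕₁ η) ⨾ μ ≈ ρ
      μ-comm   : σ ⨾ μ ≈ μ
      δ-assoc  : δ ⨾ (δ ⊕₁ id) ⨾ α ≈ δ ⨾ (id ⊕₁ δ)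
      δ-unitˡ  : δ ⨾ (ε ⊕₁ id) ⨾ λ′ ≈ id
      δ-unitʳ  : δ ⨾ (id ⊕₁ ε) ⨾ ρ ≈ id
      δ-comm   : δ ⨾ σ ≈ δ
      frobeniusˡ : (δ ⊕₁ id) ⨾ α ⨾ (id ⊕₁ μ) ≈ μ ⨾ δ
      frobeniusʳ : (id ⊕₁ δ) ⨾ α⁻¹ ⨾ (μ ⊕₁ id) ≈ μ ⨾ δ
      special  : δ ⨾ μ ≈ id
      adj-unit₁ : id ≤ ε ⨾ η
      adj-unit₂ : η ⨾ ε ≤ id
      adj-mult₁ : id ≤ δ ⨾ μ
      adj-mult₂ : μ ⨾ δ ≤ id

  record IsPreorderedCartesianBicategory : Set (o ⊔ ℓ ⊔ e) where
    field
      isPreorder : ∀ {X Y} → IsPreorder (_≈_ {X} {Y}) _≤_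
      ⨾-resp-≈   : ∀ {X Y Z} {f f′ : Hom X Y} {g g′ : Hom Y Z} →
                   f ≈ f′ → g ≈ g′ → f ⨾ g ≈ f′ ⨾ g′
      ⨾-mono     : ∀ {X Y Z} {f f′ : Hom X Y} {g g′ : Hom Y Z} →
                   f ≤ f′ → g ≤ g′ → f ⨾ g ≤ f′ ⨾ g′
      assoc      : ∀ {W X Y Z} {f : Hom W X} {g : Hom X Y} {h : Hom Y Z} →
                   (f ⨾ g) ⨾ h ≈ f ⨾ (g ⨾ h)
      identityˡ  : ∀ {X Y} {f : Hom X Y} → id ⨾ f ≈ f
      identityʳ  : ∀ {X Y} {f : Hom X Y} → f ⨾ id ≈ f
      ⊕-resp-≈   : ∀ {X Y X′ Y′} {f g : Hom X Y} {f′ g′ : Hom X′ Y′} →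
                   f ≈ g → f′ ≈ g′ → f ⊕₁ f′ ≈ g ⊕₁ g′
      ⊕-mono     : ∀ {X Y X′ Y′} {f g : Hom X Y} {f′ g′ : Hom X′ Y′} →
                   f ≤ g → f′ ≤ g′ → f ⊕₁ f′ ≤ g ⊕₁ g′
      ⊕-id       : ∀ {X Y} → id {X} ⊕₁ id {Y} ≈ id
      ⊕-⨾        : ∀ {X Y Z X′ Y′ Z′} {f : Hom X Y} {g : Hom Y Z}
                   {f′ : Hom X′ Y′} {g′ : Hom Y′ Z′} →
                   (f ⨾ g) ⊕₁ (f′ ⨾ g′) ≈ (f ⊕₁ f′) ⨾ (g ⊕₁ g′)
      α-isoˡ     : ∀ {X Y Z} → α {X} {Y} {Z} ⨾ α⁻¹ ≈ id
      α-isoʳ     : ∀ {X Y Z} → α⁻¹ {X} {Y} {Z} ⨾ α ≈ id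
      λ-isoˡ     : ∀ {X} → λ′ {X} ⨾ λ′⁻¹ ≈ id
      λ-isoʳ     : ∀ {X} → λ′⁻¹ {X} ⨾ λ′ ≈ id
      ρ-isoˡ     : ∀ {X} → ρ {X} ⨾ ρ⁻¹ ≈ id
      ρ-isoʳ     : ∀ {X} → ρ⁻¹ {X} ⨾ ρ ≈ id
      σ-inv      : ∀ {X Y} → σ {X} {Y} ⨾ σ ≈ id
      α-natural  : ∀ {X Y Z X′ Y′ Z′} {f : Hom X X′} {g : Hom Y Y′} {h : Hom Z Z′} →
                   ((f ⊕₁ g) ⊕₁ h) ⨾ α ≈ α ⨾ (f ⊕₁ (g ⊕₁ h))
      λ-natural  : ∀ {X Y} {f : Hom X Y} → (id ⊕₁ f) ⨾ λ′ ≈ λ′ ⨾ f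
      ρ-natural  : ∀ {X Y} {f : Hom X Y} → (f ⊕₁ id) ⨾ ρ ≈ ρ ⨾ f
      σ-natural  : ∀ {X Y X′ Y′} {f : Hom X X′} {g : Hom Y Y′} →
                   (f ⊕₁ g) ⨾ σ ≈ σ ⨾ (g ⊕₁ f)
      pentagon   : ∀ {W X Y Z} →
                   α {W ⊕ X} {Y} {Z} ⨾ α {W} {X} {Y ⊕ Z}
                     ≈ (α {W} {X} {Y} ⊕₁ id {Z}) ⨾ α {W} {X ⊕ Y} {Z} ⨾ (id {W} ⊕₁ α {X} {Y} {Z})
      triangle   : ∀ {X Y} →
                   α {X} {I} {Y} ⨾ (id {X} ⊕₁ λ′ {Y}) ≈ ρ {X} ⊕₁ id {Y}
      hexagon    : ∀ {X Y Z} →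
                   α {X} {Y} {Z} ⨾ σ {X} {Y ⊕ Z} ⨾ α {Y} {Z} {X}
                     ≈ (σ {X} {Y} ⊕₁ id {Z}) ⨾ α {Y} {X} {Z} ⨾ (id {Y} ⊕₁ σ {X} {Z})
      frobenius  : ∀ X → FrobeniusBimonoid X
      lax-δ      : ∀ {X Y} (R : Hom X Y) →
                   R ⨾ FrobeniusBimonoid.δ (frobenius Y)
                     ≤ FrobeniusBimonoid.δ (frobenius X) ⨾ (R ⊕₁ R)
      lax-ε      : ∀ {X Y} (R : Hom X Y) →
                   R ⨾ FrobeniusBimonoid.ε (frobenius Y) ≤ FrobeniusBimonoid.ε (frobenius X)

module CospanConstruction {o ℓ e} (C : Category o ℓ e)
                          (fc : FinitelyCocomplete C) where
  open Category C
  open FinitelyCocomplete fc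

  infixr 6 _+_ _+₁_

  0C : Obj
  0C = Initial.⊥ initial

  ¡ : ∀ {A} → 0C ⇒ A
  ¡ = Initial.! initial

  _+_ : Obj → Obj → Obj
  A + B = Coproduct.A+B (coproduct A B)

  ι₁ : ∀ {A B} → A ⇒ A + B
  ι₁ {A} {B} = Coproduct.i₁ (coproduct A B)

  ι₂ : ∀ {A B} → B ⇒ A + B
  ι₂ {A} {B} = Coproduct.i₂ (coproduct A B)

  copair : ∀ {A B X} → A ⇒ X → B ⇒ X → A + B ⇒ X
  copair {A} {B} = Coproduct.[_,_] (coproduct A B)

  _+₁_ : ∀ {A B A′ B′} → A ⇒ B → A′ ⇒ B′ → A + A′ ⇒ B + B′
  f +₁ g = copair (ι₁ ∘ f) (ι₂ ∘ g)

  record Cospan (X Y : Obj) : Set (o ⊔ ℓ) where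
    constructor cospan
    field
      apex  : Obj
      left  : X ⇒ apex
      right : Y ⇒ apex
  open Cospan

  _≅c_ : ∀ {X Y} → Rel (Cospan X Y) (ℓ ⊔ e)
  c ≅c d = Σ (apex c ⇒ apex d) λ φ → Σ (apex d ⇒ apex c) λ ψ →
             (ψ ∘ φ ≈ id) × (φ ∘ ψ ≈ id) ×
             (φ ∘ left c ≈ left d) × (φ ∘ right c ≈ right d)

  _≤c_ : ∀ {X Y} → Rel (Cospan X Y) (ℓ ⊔ e)
  c ≤c d = Σ (apex d ⇒ apex c) λ h →
             (h ∘ left d ≈ left c) × (h ∘ right d ≈ right c)

  idc : ∀ {X} → Cospan X X
  idc {X} = cospan X id id

  -- composition by (chosen) pushout, constructed as a coequalizer of
  -- the two maps Y ⇒ A + B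
  _⨾c_ : ∀ {X Y Z} → Cospan X Y → Cospan Y Z → Cospan X Z
  c ⨾c d = cospan P (q ∘ ι₁ ∘ left c) (q ∘ ι₂ ∘ right d)
    where
      ce = coequalizer (ι₁ {apex c} {apex d} ∘ right c) (ι₂ ∘ left d)
      P = Coequalizer.obj ce
      q = Coequalizer.arr ce

  _⊕c_ : ∀ {X Y X′ Y′} → Cospan X Y → Cospan X′ Y′ → Cospan (X + X′) (Y + Y′)
  c ⊕c d = cospan (apex c + apex d) (left c +₁ left d) (right c +₁ right d)

  ⌜_⌝ : ∀ {X Y} → X ⇒ Y → Cospan X Y
  ⌜_⌝ {X} {Y} f = cospan Y f id

  assocC : ∀ {A B D} → (A + B) + D ⇒ A + (B + D)
  assocC = copair (copair ι₁ (ι₂ ∘ ι₁)) (ι₂ ∘ ι₂)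

  assocC⁻¹ : ∀ {A B D} → A + (B + D) ⇒ (A + B) + D
  assocC⁻¹ = copair (ι₁ ∘ ι₁) (copair (ι₁ ∘ ι₂) ι₂)

  CospanLeq : SMCData o (o ⊔ ℓ) (ℓ ⊔ e)
  CospanLeq = record
    { Obj  = Obj
    ; Hom  = Cospan
    ; _≈_  = _≅c_
    ; _≤_  = _≤c_
    ; id   = idc
    ; _⨾_  = _⨾c_
    ; _⊕_  = _+_
    ; _⊕₁_ = _⊕c_
    ; I    = 0C
    ; α    = ⌜ assocC ⌝
    ; α⁻¹  = ⌜ assocC⁻¹ ⌝
    ; λ′   = ⌜ copair ¡ id ⌝
    ; λ′⁻¹ = ⌜ ι₂ ⌝
    ; ρ    = ⌜ copair id ¡ ⌝
    ; ρ⁻¹  = ⌜ ι₁ ⌝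
    ; σ    = ⌜ copair ι₂ ι₁ ⌝
    }

module Submission where

-- The whole argument rests on one device:
-- a commuting square that is jointly epic and maps compatibly into the
-- chosen pushout is itself a pushout, so the composite is isomorphic to the
-- cospan it determines (pushout-square-≅); dually, every cocone on the inner
-- legs gives a cospan below the composite (cocone-≤).  With these,
--   * associativity, units and the interchange law with ⊕ are pushout
--     recognitions;
--   * composing with the image ⌜ f ⌝ or ⌞ g ⌟ of a C-arrow just pre- or
--     post-composes a leg, so ⌜_⌝ and ⌞_⌟ are (contra)functors preserving ⊕;
--     hence every structural law (monoidal coherence, (co)monoid laws)
--     reduces to an equation between canonical coproduct maps in C;
--   * the Frobenius and speciality laws are the computations of three
--     pushouts whose apex is X, and adjointness and laxity are cocones.

open import Defs
open import Level using (_⊔_)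
open import Data.Product using (_×_; _,_; proj₁; proj₂)
open import Relation.Binary using (Setoid; IsEquivalence)
import Relation.Binary.Reasoning.Setoid as SetoidReasoning

module CategoryReasoning {o ℓ e} (C : Category o ℓ e) where
  open Category C

  private variable A B D E W : Obj

  hom-setoid : Obj → Obj → Setoid ℓ e
  hom-setoid A B = record { Carrier = A ⇒ B ; _≈_ = _≈_ ; isEquivalence = equiv }

  module HomReasoning {A B : Obj} = SetoidReasoning (hom-setoid A B)
  open HomReasoning public using (begin_; _∎; step-≈-⟩; step-≈-⟨)

  module _ {A B : Obj} where
    open IsEquivalence (equiv {A} {B}) public
      using () renaming (refl to ≈-refl; sym to ≈-sym; trans to ≈-trans)

  infixr 5 _⟫_
  _⟫_ : {f g h : A ⇒ B} → f ≈ g → g ≈ h → f ≈ h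
  _⟫_ = ≈-trans

  meet : {f g h : A ⇒ B} → f ≈ h → g ≈ h → f ≈ g
  meet p q = p ⟫ ≈-sym q

  infixr 6 refl⟩∘⟨_
  infixl 6 _⟩∘⟨refl
  refl⟩∘⟨_ : {f : B ⇒ D} {g i : A ⇒ B} → g ≈ i → f ∘ g ≈ f ∘ i
  refl⟩∘⟨ p = ∘-resp-≈ ≈-refl p

  _⟩∘⟨refl : {f h : B ⇒ D} {g : A ⇒ B} → f ≈ h → f ∘ g ≈ h ∘ g
  p ⟩∘⟨refl = ∘-resp-≈ p ≈-refl

  sym-assoc : {f : A ⇒ B} {g : B ⇒ D} {h : D ⇒ E} → h ∘ (g ∘ f) ≈ (h ∘ g) ∘ f
  sym-assoc = ≈-sym assoc

  pullˡ : {a : D ⇒ E} {b : B ⇒ D} {c : B ⇒ E} {f : A ⇒ B} →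
          a ∘ b ≈ c → a ∘ (b ∘ f) ≈ c ∘ f
  pullˡ p = sym-assoc ⟫ p ⟩∘⟨refl

  pullʳ : {a : D ⇒ E} {b : B ⇒ D} {f : A ⇒ B} {c : A ⇒ D} →
          b ∘ f ≈ c → (a ∘ b) ∘ f ≈ a ∘ c
  pullʳ p = assoc ⟫ refl⟩∘⟨ p

  cancelˡ : {a : D ⇒ B} {b : B ⇒ D} {f : A ⇒ B} → a ∘ b ≈ id → a ∘ (b ∘ f) ≈ f
  cancelˡ p = pullˡ p ⟫ identityˡ

  cancelʳ : {f : B ⇒ D} {a : A ⇒ B} {b : B ⇒ A} → a ∘ b ≈ id → (f ∘ a) ∘ b ≈ f
  cancelʳ p = pullʳ p ⟫ identityʳ

  transpose : {φ : A ⇒ B} {ψ : B ⇒ A} {x : D ⇒ A} {y : D ⇒ B} →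
              ψ ∘ φ ≈ id → φ ∘ x ≈ y → ψ ∘ y ≈ x
  transpose ψφ p = refl⟩∘⟨ ≈-sym p ⟫ cancelˡ ψφ

  square-at : {k m : D ⇒ B} {h₁ h₂ : B ⇒ E} {x : A ⇒ D} {y z : A ⇒ B} →
              h₁ ∘ k ≈ h₂ ∘ m → k ∘ x ≈ y → m ∘ x ≈ z → h₁ ∘ y ≈ h₂ ∘ z
  square-at sq kx mx = refl⟩∘⟨ ≈-sym kx ⟫ sym-assoc ⟫ sq ⟩∘⟨refl ⟫ assoc ⟫ refl⟩∘⟨ mx

  agree-via : {a : A ⇒ E} {x : D ⇒ E} {y : D ⇒ A} {s t : E ⇒ W} →
              x ≈ a ∘ y → s ∘ a ≈ t ∘ a → s ∘ x ≈ t ∘ x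
  agree-via x≈ay sa≈ta = refl⟩∘⟨ x≈ay ⟫ pullˡ sa≈ta ⟫ assoc ⟫ refl⟩∘⟨ ≈-sym x≈ay

  split-epic : {a : A ⇒ B} {r : B ⇒ A} {s t : B ⇒ D} → a ∘ r ≈ id → s ∘ a ≈ t ∘ a → s ≈ t
  split-epic {a = a} {r} {s} {t} ar sa = begin
    s            ≈⟨ identityʳ ⟨
    s ∘ id       ≈⟨ refl⟩∘⟨ ar ⟨
    s ∘ (a ∘ r)  ≈⟨ sym-assoc ⟩
    (s ∘ a) ∘ r  ≈⟨ sa ⟩∘⟨refl ⟩
    (t ∘ a) ∘ r  ≈⟨ cancelʳ ar ⟩
    t            ∎

  JointlyEpic : A ⇒ E → B ⇒ E → Set (o ⊔ ℓ ⊔ e)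
  JointlyEpic {E = E} a b =
    ∀ {W} {s t : E ⇒ W} → s ∘ a ≈ t ∘ a → s ∘ b ≈ t ∘ b → s ≈ t

  jointly-epic-idˡ : {b : B ⇒ E} → JointlyEpic id b
  jointly-epic-idˡ p _ = ≈-sym identityʳ ⟫ p ⟫ identityʳ

  jointly-epic-idʳ : {a : A ⇒ E} → JointlyEpic a id
  jointly-epic-idʳ _ q = ≈-sym identityʳ ⟫ q ⟫ identityʳ

  record Iso (A B : Obj) : Set (ℓ ⊔ e) where
    field
      to   : A ⇒ B
      from : B ⇒ A
      isoˡ : from ∘ to ≈ id
      isoʳ : to ∘ from ≈ id

  Iso-sym : Iso A B → Iso B A
  Iso-sym i = record { to = from ; from = to ; isoˡ = isoʳ ; isoʳ = isoˡ }
    where open Iso i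

module CoproductCalculus {o ℓ e} (C : Category o ℓ e) (fc : FinitelyCocomplete C) where
  open Category C
  open CategoryReasoning C
  open FinitelyCocomplete fc
  open CospanConstruction C fc using (0C; ¡; _+_; ι₁; ι₂; copair; _+₁_; assocC; assocC⁻¹)

  private variable A B D A′ B′ D′ E E′ Q W X : Obj

  inject₁ : {f : A ⇒ X} {g : B ⇒ X} → copair f g ∘ ι₁ ≈ f
  inject₁ {A = A} {B = B} = Coproduct.inject₁ (coproduct A B)

  inject₂ : {f : A ⇒ X} {g : B ⇒ X} → copair f g ∘ ι₂ ≈ g
  inject₂ {A = A} {B = B} = Coproduct.inject₂ (coproduct A B)

  +-ext : {h k : A + B ⇒ X} → h ∘ ι₁ ≈ k ∘ ι₁ → h ∘ ι₂ ≈ k ∘ ι₂ → h ≈ k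
  +-ext {A = A} {B = B} p q =
    ≈-trans (≈-sym (Coproduct.unique (coproduct A B) p q))
            (Coproduct.unique (coproduct A B) ≈-refl ≈-refl)

  ¡-unique : (f g : 0C ⇒ A) → f ≈ g
  ¡-unique f g = ≈-trans (≈-sym (Initial.!-unique initial f)) (Initial.!-unique initial g)

  -- Component rules, in the right-nested form used by all computations.
  copair-ι₁ : {f : A ⇒ X} {g : B ⇒ X} {x : Q ⇒ A} → copair f g ∘ (ι₁ ∘ x) ≈ f ∘ x
  copair-ι₁ = pullˡ inject₁

  copair-ι₂ : {f : A ⇒ X} {g : B ⇒ X} {x : Q ⇒ B} → copair f g ∘ (ι₂ ∘ x) ≈ g ∘ x
  copair-ι₂ = pullˡ inject₂

  +₁-ι₁ : {f : A ⇒ A′} {g : B ⇒ B′} → (f +₁ g) ∘ ι₁ ≈ ι₁ ∘ f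
  +₁-ι₁ = inject₁

  +₁-ι₂ : {f : A ⇒ A′} {g : B ⇒ B′} → (f +₁ g) ∘ ι₂ ≈ ι₂ ∘ g
  +₁-ι₂ = inject₂

  +₁-ι₁∘ : {f : A ⇒ A′} {g : B ⇒ B′} {x : Q ⇒ A} → (f +₁ g) ∘ (ι₁ ∘ x) ≈ ι₁ ∘ (f ∘ x)
  +₁-ι₁∘ = copair-ι₁ ⟫ assoc

  +₁-ι₂∘ : {f : A ⇒ A′} {g : B ⇒ B′} {x : Q ⇒ B} → (f +₁ g) ∘ (ι₂ ∘ x) ≈ ι₂ ∘ (g ∘ x)
  +₁-ι₂∘ = copair-ι₂ ⟫ assoc

  +-ext₃ : {h k : (A + B) + D ⇒ X} →
           h ∘ (ι₁ ∘ ι₁) ≈ k ∘ (ι₁ ∘ ι₁) → h ∘ (ι₁ ∘ ι₂) ≈ k ∘ (ι₁ ∘ ι₂) →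
           h ∘ ι₂ ≈ k ∘ ι₂ → h ≈ k
  +-ext₃ p q r = +-ext (+-ext (assoc ⟫ p ⟫ sym-assoc) (assoc ⟫ q ⟫ sym-assoc)) r

  +-ext₃′ : {h k : A + (B + D) ⇒ X} →
            h ∘ ι₁ ≈ k ∘ ι₁ → h ∘ (ι₂ ∘ ι₁) ≈ k ∘ (ι₂ ∘ ι₁) →
            h ∘ (ι₂ ∘ ι₂) ≈ k ∘ (ι₂ ∘ ι₂) → h ≈ k
  +-ext₃′ p q r = +-ext p (+-ext (assoc ⟫ q ⟫ sym-assoc) (assoc ⟫ r ⟫ sym-assoc))

  +-ext₄ : {h k : ((A + B) + D) + E ⇒ X} →
           h ∘ (ι₁ ∘ (ι₁ ∘ ι₁)) ≈ k ∘ (ι₁ ∘ (ι₁ ∘ ι₁)) →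
           h ∘ (ι₁ ∘ (ι₁ ∘ ι₂)) ≈ k ∘ (ι₁ ∘ (ι₁ ∘ ι₂)) →
           h ∘ (ι₁ ∘ ι₂) ≈ k ∘ (ι₁ ∘ ι₂) → h ∘ ι₂ ≈ k ∘ ι₂ → h ≈ k
  +-ext₄ p q r t =
    +-ext (+-ext₃ (assoc ⟫ p ⟫ sym-assoc) (assoc ⟫ q ⟫ sym-assoc) (assoc ⟫ r ⟫ sym-assoc)) t

  +₁-resp : {f g : A ⇒ B} {f′ g′ : A′ ⇒ B′} → f ≈ g → f′ ≈ g′ → f +₁ f′ ≈ g +₁ g′
  +₁-resp p q = +-ext (+₁-ι₁ ⟫ refl⟩∘⟨ p ⟫ ≈-sym +₁-ι₁) (+₁-ι₂ ⟫ refl⟩∘⟨ q ⟫ ≈-sym +₁-ι₂)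

  +₁-id : id {A} +₁ id {B} ≈ id
  +₁-id = +-ext (+₁-ι₁ ⟫ identityʳ ⟫ ≈-sym identityˡ) (+₁-ι₂ ⟫ identityʳ ⟫ ≈-sym identityˡ)

  +₁-∘ : {f : B ⇒ D} {g : A ⇒ B} {f′ : B′ ⇒ D′} {g′ : A′ ⇒ B′} →
         (f +₁ f′) ∘ (g +₁ g′) ≈ (f ∘ g) +₁ (f′ ∘ g′)
  +₁-∘ = +-ext (pullʳ +₁-ι₁ ⟫ +₁-ι₁∘ ⟫ ≈-sym +₁-ι₁) (pullʳ +₁-ι₂ ⟫ +₁-ι₂∘ ⟫ ≈-sym +₁-ι₂)

  restrict-ι₁ : {f : A ⇒ B} {f′ : A′ ⇒ B′} {g : A ⇒ D} {g′ : A′ ⇒ D′}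
                {h : B + B′ ⇒ X} {k : D + D′ ⇒ X} →
                h ∘ (f +₁ f′) ≈ k ∘ (g +₁ g′) → (h ∘ ι₁) ∘ f ≈ (k ∘ ι₁) ∘ g
  restrict-ι₁ {f = f} {f′} {g} {g′} {h} {k} sq = begin
    (h ∘ ι₁) ∘ f          ≈⟨ assoc ⟩
    h ∘ (ι₁ ∘ f)          ≈⟨ refl⟩∘⟨ +₁-ι₁ ⟨
    h ∘ ((f +₁ f′) ∘ ι₁)  ≈⟨ sym-assoc ⟩
    (h ∘ (f +₁ f′)) ∘ ι₁  ≈⟨ sq ⟩∘⟨refl ⟩
    (k ∘ (g +₁ g′)) ∘ ι₁  ≈⟨ pullʳ +₁-ι₁ ⟩
    k ∘ (ι₁ ∘ g)          ≈⟨ sym-assoc ⟩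
    (k ∘ ι₁) ∘ g          ∎

  restrict-ι₂ : {f : A ⇒ B} {f′ : A′ ⇒ B′} {g : A ⇒ D} {g′ : A′ ⇒ D′}
                {h : B + B′ ⇒ X} {k : D + D′ ⇒ X} →
                h ∘ (f +₁ f′) ≈ k ∘ (g +₁ g′) → (h ∘ ι₂) ∘ f′ ≈ (k ∘ ι₂) ∘ g′
  restrict-ι₂ {f = f} {f′} {g} {g′} {h} {k} sq = begin
    (h ∘ ι₂) ∘ f′         ≈⟨ assoc ⟩
    h ∘ (ι₂ ∘ f′)         ≈⟨ refl⟩∘⟨ +₁-ι₂ ⟨
    h ∘ ((f +₁ f′) ∘ ι₂)  ≈⟨ sym-assoc ⟩
    (h ∘ (f +₁ f′)) ∘ ι₂  ≈⟨ sq ⟩∘⟨refl ⟩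
    (k ∘ (g +₁ g′)) ∘ ι₂  ≈⟨ pullʳ +₁-ι₂ ⟩
    k ∘ (ι₂ ∘ g′)         ≈⟨ sym-assoc ⟩
    (k ∘ ι₂) ∘ g′         ∎

  +₁-jointly-epic : {a : A ⇒ E} {b : B ⇒ E} {a′ : A′ ⇒ E′} {b′ : B′ ⇒ E′} →
    JointlyEpic a b → JointlyEpic a′ b′ → JointlyEpic (a +₁ a′) (b +₁ b′)
  +₁-jointly-epic epic epic′ sa ta =
    +-ext (epic (restrict-ι₁ sa) (restrict-ι₁ ta)) (epic′ (restrict-ι₂ sa) (restrict-ι₂ ta))

  ∇ : A + A ⇒ A
  ∇ = copair id id

  σC : A + B ⇒ B + A
  σC = copair ι₂ ι₁

  λC : 0C + A ⇒ A
  λC = copair ¡ id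

  ρC : A + 0C ⇒ A
  ρC = copair id ¡

  assocC-ι₁ι₁ : assocC {A} {B} {D} ∘ (ι₁ ∘ ι₁) ≈ ι₁
  assocC-ι₁ι₁ = copair-ι₁ ⟫ inject₁

  assocC-ι₁ι₂ : assocC {A} {B} {D} ∘ (ι₁ ∘ ι₂) ≈ ι₂ ∘ ι₁
  assocC-ι₁ι₂ = copair-ι₁ ⟫ inject₂

  assocC-ι₂ : assocC {A} {B} {D} ∘ ι₂ ≈ ι₂ ∘ ι₂
  assocC-ι₂ = inject₂

  assocC⁻¹-ι₁ : assocC⁻¹ {A} {B} {D} ∘ ι₁ ≈ ι₁ ∘ ι₁
  assocC⁻¹-ι₁ = inject₁

  assocC⁻¹-ι₂ι₁ : assocC⁻¹ {A} {B} {D} ∘ (ι₂ ∘ ι₁) ≈ ι₁ ∘ ι₂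
  assocC⁻¹-ι₂ι₁ = copair-ι₂ ⟫ inject₁

  assocC⁻¹-ι₂ι₂ : assocC⁻¹ {A} {B} {D} ∘ (ι₂ ∘ ι₂) ≈ ι₂
  assocC⁻¹-ι₂ι₂ = copair-ι₂ ⟫ inject₂

  assocC-ι₁ι₁∘ : {x : Q ⇒ A} → assocC {A} {B} {D} ∘ (ι₁ ∘ (ι₁ ∘ x)) ≈ ι₁ ∘ x
  assocC-ι₁ι₁∘ = refl⟩∘⟨ sym-assoc ⟫ pullˡ assocC-ι₁ι₁

  assocC-ι₁ι₂∘ : {x : Q ⇒ B} → assocC {A} {B} {D} ∘ (ι₁ ∘ (ι₂ ∘ x)) ≈ ι₂ ∘ (ι₁ ∘ x)
  assocC-ι₁ι₂∘ = refl⟩∘⟨ sym-assoc ⟫ pullˡ assocC-ι₁ι₂ ⟫ assoc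

  assocC-ι₂∘ : {x : Q ⇒ D} → assocC {A} {B} {D} ∘ (ι₂ ∘ x) ≈ ι₂ ∘ (ι₂ ∘ x)
  assocC-ι₂∘ = pullˡ assocC-ι₂ ⟫ assoc

  assocC-iso : Iso ((A + B) + D) (A + (B + D))
  assocC-iso = record
    { to   = assocC
    ; from = assocC⁻¹
    ; isoˡ = +-ext₃ (pullʳ assocC-ι₁ι₁ ⟫ assocC⁻¹-ι₁ ⟫ ≈-sym identityˡ)
                    (pullʳ assocC-ι₁ι₂ ⟫ assocC⁻¹-ι₂ι₁ ⟫ ≈-sym identityˡ)
                    (pullʳ assocC-ι₂ ⟫ assocC⁻¹-ι₂ι₂ ⟫ ≈-sym identityˡ)
    ; isoʳ = +-ext₃′ (pullʳ assocC⁻¹-ι₁ ⟫ assocC-ι₁ι₁ ⟫ ≈-sym identityˡ)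
                     (pullʳ assocC⁻¹-ι₂ι₁ ⟫ assocC-ι₁ι₂ ⟫ ≈-sym identityˡ)
                     (pullʳ assocC⁻¹-ι₂ι₂ ⟫ assocC-ι₂ ⟫ ≈-sym identityˡ)
    }

  σC-iso : Iso (A + B) (B + A)
  σC-iso = record { to = σC ; from = σC ; isoˡ = σC-invol ; isoʳ = σC-invol }
    where
      σC-invol : ∀ {A B} → σC ∘ σC {A} {B} ≈ id
      σC-invol = +-ext (pullʳ inject₁ ⟫ inject₂ ⟫ ≈-sym identityˡ)
                       (pullʳ inject₂ ⟫ inject₁ ⟫ ≈-sym identityˡ)

  λC-iso : Iso (0C + A) A
  λC-iso = record
    { to   = λC
    ; from = ι₂
    ; isoˡ = +-ext (¡-unique _ _) (pullʳ inject₂ ⟫ identityʳ ⟫ ≈-sym identityˡ)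
    ; isoʳ = inject₂
    }

  ρC-iso : Iso (A + 0C) A
  ρC-iso = record
    { to   = ρC
    ; from = ι₁
    ; isoˡ = +-ext (pullʳ inject₁ ⟫ identityʳ ⟫ ≈-sym identityˡ) (¡-unique _ _)
    ; isoʳ = inject₁
    }

  assocC-natural : {f : A ⇒ A′} {g : B ⇒ B′} {h : D ⇒ D′} →
                   assocC ∘ ((f +₁ g) +₁ h) ≈ (f +₁ (g +₁ h)) ∘ assocC
  assocC-natural = +-ext₃
    (meet (pullʳ (+₁-ι₁∘ ⟫ refl⟩∘⟨ +₁-ι₁) ⟫ assocC-ι₁ι₁∘) (pullʳ assocC-ι₁ι₁ ⟫ +₁-ι₁))
    (meet (pullʳ (+₁-ι₁∘ ⟫ refl⟩∘⟨ +₁-ι₂) ⟫ assocC-ι₁ι₂∘)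
          (pullʳ assocC-ι₁ι₂ ⟫ +₁-ι₂∘ ⟫ refl⟩∘⟨ +₁-ι₁))
    (meet (pullʳ +₁-ι₂ ⟫ assocC-ι₂∘) (pullʳ assocC-ι₂ ⟫ +₁-ι₂∘ ⟫ refl⟩∘⟨ +₁-ι₂))

  σC-natural : {f : A ⇒ A′} {g : B ⇒ B′} → σC ∘ (f +₁ g) ≈ (g +₁ f) ∘ σC
  σC-natural = +-ext (meet (pullʳ +₁-ι₁ ⟫ copair-ι₁) (pullʳ inject₁ ⟫ +₁-ι₂))
                     (meet (pullʳ +₁-ι₂ ⟫ copair-ι₂) (pullʳ inject₂ ⟫ +₁-ι₁))

  λC-natural : {f : A ⇒ B} → λC ∘ (id +₁ f) ≈ f ∘ λC
  λC-natural = +-ext (¡-unique _ _)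
    (meet (pullʳ +₁-ι₂ ⟫ copair-ι₂ ⟫ identityˡ) (pullʳ inject₂ ⟫ identityʳ))

  ρC-natural : {f : A ⇒ B} → ρC ∘ (f +₁ id) ≈ f ∘ ρC
  ρC-natural = +-ext
    (meet (pullʳ +₁-ι₁ ⟫ copair-ι₁ ⟫ identityˡ) (pullʳ inject₁ ⟫ identityʳ))
    (¡-unique _ _)

  pentagonC : assocC {W} {X} {A + B} ∘ assocC {W + X} {A} {B}
              ≈ (id +₁ assocC) ∘ (assocC ∘ (assocC +₁ id))
  pentagonC = +-ext₄
    (meet (assoc ⟫ refl⟩∘⟨ assocC-ι₁ι₁∘ ⟫ assocC-ι₁ι₁)
          (assoc ⟫ refl⟩∘⟨ (assoc ⟫ refl⟩∘⟨ (+₁-ι₁∘ ⟫ refl⟩∘⟨ assocC-ι₁ι₁) ⟫ assocC-ι₁ι₁)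
                 ⟫ +₁-ι₁ ⟫ identityʳ))
    (meet (assoc ⟫ refl⟩∘⟨ assocC-ι₁ι₁∘ ⟫ assocC-ι₁ι₂)
          (assoc ⟫ refl⟩∘⟨ (assoc ⟫ refl⟩∘⟨ (+₁-ι₁∘ ⟫ refl⟩∘⟨ assocC-ι₁ι₂) ⟫ assocC-ι₁ι₂∘)
                 ⟫ +₁-ι₂∘ ⟫ refl⟩∘⟨ assocC-ι₁ι₁))
    (meet (assoc ⟫ refl⟩∘⟨ assocC-ι₁ι₂ ⟫ assocC-ι₂∘)
          (assoc ⟫ refl⟩∘⟨ (assoc ⟫ refl⟩∘⟨ (+₁-ι₁∘ ⟫ refl⟩∘⟨ assocC-ι₂) ⟫ assocC-ι₁ι₂∘)
                 ⟫ +₁-ι₂∘ ⟫ refl⟩∘⟨ assocC-ι₁ι₂))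
    (meet (assoc ⟫ refl⟩∘⟨ assocC-ι₂ ⟫ assocC-ι₂∘)
          (assoc ⟫ refl⟩∘⟨ (assoc ⟫ refl⟩∘⟨ (+₁-ι₂ ⟫ identityʳ) ⟫ assocC-ι₂)
                 ⟫ +₁-ι₂∘ ⟫ refl⟩∘⟨ assocC-ι₂))

  triangleC : (id +₁ λC) ∘ assocC {X} {0C} {A} ≈ ρC +₁ id
  triangleC = +-ext₃
    (meet (assoc ⟫ refl⟩∘⟨ assocC-ι₁ι₁ ⟫ +₁-ι₁ ⟫ identityʳ) (+₁-ι₁∘ ⟫ refl⟩∘⟨ inject₁ ⟫ identityʳ))
    (¡-unique _ _)
    (meet (assoc ⟫ refl⟩∘⟨ assocC-ι₂ ⟫ +₁-ι₂∘ ⟫ refl⟩∘⟨ inject₂) +₁-ι₂)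

  hexagonC : assocC {B} {D} {A} ∘ (σC ∘ assocC {A} {B} {D})
             ≈ (id +₁ σC) ∘ (assocC ∘ (σC +₁ id))
  hexagonC = +-ext₃
    (meet (assoc ⟫ refl⟩∘⟨ (assoc ⟫ refl⟩∘⟨ assocC-ι₁ι₁ ⟫ inject₁) ⟫ assocC-ι₂)
          (assoc ⟫ refl⟩∘⟨ (assoc ⟫ refl⟩∘⟨ (+₁-ι₁∘ ⟫ refl⟩∘⟨ inject₁) ⟫ assocC-ι₁ι₂)
                 ⟫ +₁-ι₂∘ ⟫ refl⟩∘⟨ inject₁))
    (meet (assoc ⟫ refl⟩∘⟨ (assoc ⟫ refl⟩∘⟨ assocC-ι₁ι₂ ⟫ copair-ι₂) ⟫ assocC-ι₁ι₁)
          (assoc ⟫ refl⟩∘⟨ (assoc ⟫ refl⟩∘⟨ (+₁-ι₁∘ ⟫ refl⟩∘⟨ inject₂) ⟫ assocC-ι₁ι₁)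
                 ⟫ +₁-ι₁ ⟫ identityʳ))
    (meet (assoc ⟫ refl⟩∘⟨ (assoc ⟫ refl⟩∘⟨ assocC-ι₂ ⟫ copair-ι₂) ⟫ assocC-ι₁ι₂)
          (assoc ⟫ refl⟩∘⟨ (assoc ⟫ refl⟩∘⟨ (+₁-ι₂ ⟫ identityʳ) ⟫ assocC-ι₂)
                 ⟫ +₁-ι₂∘ ⟫ refl⟩∘⟨ inject₂))

  ∇-assoc : ∇ ∘ (∇ +₁ id) ≈ ∇ ∘ ((id +₁ ∇) ∘ assocC {A} {A} {A})
  ∇-assoc = +-ext₃
    (meet (assoc ⟫ refl⟩∘⟨ (+₁-ι₁∘ ⟫ refl⟩∘⟨ inject₁ ⟫ identityʳ) ⟫ inject₁)
          (assoc ⟫ refl⟩∘⟨ (assoc ⟫ refl⟩∘⟨ assocC-ι₁ι₁ ⟫ +₁-ι₁ ⟫ identityʳ) ⟫ inject₁))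
    (meet (assoc ⟫ refl⟩∘⟨ (+₁-ι₁∘ ⟫ refl⟩∘⟨ inject₂ ⟫ identityʳ) ⟫ inject₁)
          (assoc ⟫ refl⟩∘⟨ (assoc ⟫ refl⟩∘⟨ assocC-ι₁ι₂ ⟫ +₁-ι₂∘ ⟫ refl⟩∘⟨ inject₁ ⟫ identityʳ)
                 ⟫ inject₂))
    (meet (assoc ⟫ refl⟩∘⟨ (+₁-ι₂ ⟫ identityʳ) ⟫ inject₂)
          (assoc ⟫ refl⟩∘⟨ (assoc ⟫ refl⟩∘⟨ assocC-ι₂ ⟫ +₁-ι₂∘ ⟫ refl⟩∘⟨ inject₂ ⟫ identityʳ)
                 ⟫ inject₂))

  ∇-unitˡ : ∇ ∘ (¡ +₁ id) ≈ λC {A}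
  ∇-unitˡ = +-ext (¡-unique _ _) (pullʳ +₁-ι₂ ⟫ copair-ι₂ ⟫ identityˡ ⟫ ≈-sym inject₂)

  ∇-unitʳ : ∇ ∘ (id +₁ ¡) ≈ ρC {A}
  ∇-unitʳ = +-ext (pullʳ +₁-ι₁ ⟫ copair-ι₁ ⟫ identityˡ ⟫ ≈-sym inject₁) (¡-unique _ _)

  ∇-comm : ∇ ∘ σC ≈ ∇ {A}
  ∇-comm = +-ext (pullʳ inject₁ ⟫ inject₂ ⟫ ≈-sym inject₁)
                 (pullʳ inject₂ ⟫ inject₁ ⟫ ≈-sym inject₂)

  ∇-natural : {f : A ⇒ B} → f ∘ ∇ ≈ ∇ ∘ (f +₁ f)
  ∇-natural = +-ext (pullʳ inject₁ ⟫ identityʳ ⟫ ≈-sym (pullʳ +₁-ι₁ ⟫ copair-ι₁ ⟫ identityˡ))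
                    (pullʳ inject₂ ⟫ identityʳ ⟫ ≈-sym (pullʳ +₁-ι₂ ⟫ copair-ι₂ ⟫ identityˡ))

module CospanLaws {o ℓ e} (C : Category o ℓ e) (fc : FinitelyCocomplete C) where
  open Category C
  open CategoryReasoning C
  open CoproductCalculus C fc
  open FinitelyCocomplete fc
  open CospanConstruction C fc
  open Cospan

  private variable W X Y Z X′ Y′ Z′ : Obj

  ≅c-refl : {c : Cospan X Y} → c ≅c c
  ≅c-refl = id , id , identityˡ , identityˡ , identityˡ , identityˡ

  ≅c-sym : {c d : Cospan X Y} → c ≅c d → d ≅c c
  ≅c-sym (φ , ψ , ψφ , φψ , φl , φr) = ψ , φ , φψ , ψφ , transpose ψφ φl , transpose ψφ φr

  ≅c-trans : {c d f : Cospan X Y} → c ≅c d → d ≅c f → c ≅c f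
  ≅c-trans (φ , ψ , ψφ , φψ , φl , φr) (φ′ , ψ′ , ψφ′ , φψ′ , φl′ , φr′) =
    φ′ ∘ φ , ψ ∘ ψ′ ,
    pullʳ (cancelˡ ψφ′) ⟫ ψφ , pullʳ (cancelˡ φψ) ⟫ φψ′ ,
    pullʳ φl ⟫ φl′ , pullʳ φr ⟫ φr′

  ≅c-legs : {E : Obj} {l l′ : X ⇒ E} {r r′ : Y ⇒ E} → l ≈ l′ → r ≈ r′ →
            cospan E l r ≅c cospan E l′ r′
  ≅c-legs p q = id , id , identityˡ , identityˡ , identityˡ ⟫ p , identityˡ ⟫ q

  ≅⇒≤ : {c d : Cospan X Y} → c ≅c d → c ≤c d
  ≅⇒≤ (φ , ψ , ψφ , φψ , φl , φr) = ψ , transpose ψφ φl , transpose ψφ φr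

  ≤c-trans : {c d f : Cospan X Y} → c ≤c d → d ≤c f → c ≤c f
  ≤c-trans (h , hl , hr) (h′ , hl′ , hr′) = h ∘ h′ , pullʳ hl′ ⟫ hl , pullʳ hr′ ⟫ hr

  module Pushout (c : Cospan X Y) (d : Cospan Y Z) where
    private
      coeq = coequalizer (ι₁ {apex c} {apex d} ∘ right c) (ι₂ ∘ left d)
      module Coeq = Coequalizer coeq

    P : Obj
    P = Coeq.obj

    p₁ : apex c ⇒ P
    p₁ = Coeq.arr ∘ ι₁

    p₂ : apex d ⇒ P
    p₂ = Coeq.arr ∘ ι₂

    commutes : p₁ ∘ right c ≈ p₂ ∘ left d
    commutes = assoc ⟫ Coeq.equality ⟫ sym-assoc

    left-composite : left (c ⨾c d) ≈ p₁ ∘ left c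
    left-composite = sym-assoc

    right-composite : right (c ⨾c d) ≈ p₂ ∘ right d
    right-composite = sym-assoc

    module _ {E : Obj} {a : apex c ⇒ E} {b : apex d ⇒ E} (cocone : a ∘ right c ≈ b ∘ left d) where
      private
        copair-coequalizes : copair a b ∘ (ι₁ ∘ right c) ≈ copair a b ∘ (ι₂ ∘ left d)
        copair-coequalizes = copair-ι₁ ⟫ cocone ⟫ ≈-sym copair-ι₂

      mediate : P ⇒ E
      mediate = Coeq.coequalize copair-coequalizes

      mediate-p₁ : mediate ∘ p₁ ≈ a
      mediate-p₁ = sym-assoc ⟫ ≈-sym Coeq.universal ⟩∘⟨refl ⟫ inject₁

      mediate-p₂ : mediate ∘ p₂ ≈ b
      mediate-p₂ = sym-assoc ⟫ ≈-sym Coeq.universal ⟩∘⟨refl ⟫ inject₂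

    jointly-epic : JointlyEpic p₁ p₂
    jointly-epic {s = s} {t} sp₁ sp₂ =
      Coeq.unique {eq = t-coequalizes} (≈-sym s≈t-on-arr) ⟫ ≈-sym (Coeq.unique ≈-refl)
      where
        s≈t-on-arr : s ∘ Coeq.arr ≈ t ∘ Coeq.arr
        s≈t-on-arr = +-ext (assoc ⟫ sp₁ ⟫ sym-assoc) (assoc ⟫ sp₂ ⟫ sym-assoc)
        t-coequalizes : (t ∘ Coeq.arr) ∘ (ι₁ ∘ right c) ≈ (t ∘ Coeq.arr) ∘ (ι₂ ∘ left d)
        t-coequalizes = pullʳ Coeq.equality ⟫ sym-assoc

  -- A commuting square on the inner legs of c and d that is jointly epic and
  -- maps compatibly into the chosen pushout.  Such a square is a pushout.
  record PushoutSquare {X Y Z : Obj} (c : Cospan X Y) (d : Cospan Y Z) : Set (o ⊔ ℓ ⊔ e) where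
    field
      E            : Obj
      a            : apex c ⇒ E
      b            : apex d ⇒ E
      square       : a ∘ right c ≈ b ∘ left d
      epic         : JointlyEpic a b
      comparison   : E ⇒ Pushout.P c d
      comparison-a : comparison ∘ a ≈ Pushout.p₁ c d
      comparison-b : comparison ∘ b ≈ Pushout.p₂ c d

  pushout-square-≅ : {c : Cospan X Y} {d : Cospan Y Z} (s : PushoutSquare c d) →
    let open PushoutSquare s in (c ⨾c d) ≅c cospan E (a ∘ left c) (b ∘ right d)
  pushout-square-≅ {c = c} {d} s =
    mediate square , comparison ,
    jointly-epic (pullʳ (mediate-p₁ square) ⟫ comparison-a ⟫ ≈-sym identityˡ)
                 (pullʳ (mediate-p₂ square) ⟫ comparison-b ⟫ ≈-sym identityˡ) ,
    epic (pullʳ comparison-a ⟫ mediate-p₁ square ⟫ ≈-sym identityˡ)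
         (pullʳ comparison-b ⟫ mediate-p₂ square ⟫ ≈-sym identityˡ) ,
    refl⟩∘⟨ left-composite ⟫ pullˡ (mediate-p₁ square) ,
    refl⟩∘⟨ right-composite ⟫ pullˡ (mediate-p₂ square)
    where
      open PushoutSquare s
      open Pushout c d

  cocone-≤ : {c : Cospan X Y} {d : Cospan Y Z} {E : Obj} {a : apex c ⇒ E} {b : apex d ⇒ E} →
             a ∘ right c ≈ b ∘ left d → cospan E (a ∘ left c) (b ∘ right d) ≤c (c ⨾c d)
  cocone-≤ {c = c} {d} cocone =
    mediate cocone ,
    refl⟩∘⟨ left-composite ⟫ pullˡ (mediate-p₁ cocone) ,
    refl⟩∘⟨ right-composite ⟫ pullˡ (mediate-p₂ cocone)
    where open Pushout c d

  module CompositeMap {c c′ : Cospan X Y} {d d′ : Cospan Y Z}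
                      (f : apex c ⇒ apex c′) (g : apex d ⇒ apex d′)
                      (f-right : f ∘ right c ≈ right c′) (g-left : g ∘ left d ≈ left d′) where
    private
      module P  = Pushout c d
      module P′ = Pushout c′ d′

      cocone : (P′.p₁ ∘ f) ∘ right c ≈ (P′.p₂ ∘ g) ∘ left d
      cocone = pullʳ f-right ⟫ P′.commutes ⟫ ≈-sym (pullʳ g-left)

    map : P.P ⇒ P′.P
    map = P.mediate cocone

    map-p₁ : map ∘ P.p₁ ≈ P′.p₁ ∘ f
    map-p₁ = P.mediate-p₁ cocone

    map-p₂ : map ∘ P.p₂ ≈ P′.p₂ ∘ g
    map-p₂ = P.mediate-p₂ cocone

    map-left : f ∘ left c ≈ left c′ → map ∘ left (c ⨾c d) ≈ left (c′ ⨾c d′)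
    map-left f-left =
      refl⟩∘⟨ P.left-composite ⟫ pullˡ map-p₁ ⟫ pullʳ f-left ⟫ ≈-sym P′.left-composite

    map-right : g ∘ right d ≈ right d′ → map ∘ right (c ⨾c d) ≈ right (c′ ⨾c d′)
    map-right g-right =
      refl⟩∘⟨ P.right-composite ⟫ pullˡ map-p₂ ⟫ pullʳ g-right ⟫ ≈-sym P′.right-composite

  ⨾-mono : {c c′ : Cospan X Y} {d d′ : Cospan Y Z} →
           c ≤c c′ → d ≤c d′ → (c ⨾c d) ≤c (c′ ⨾c d′)
  ⨾-mono (h , hl , hr) (k , kl , kr) = map , map-left hl , map-right kr
    where open CompositeMap h k hr kl

  ⨾-resp : {c c′ : Cospan X Y} {d d′ : Cospan Y Z} →
           c ≅c c′ → d ≅c d′ → (c ⨾c d) ≅c (c′ ⨾c d′)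
  ⨾-resp {c = c} {c′} {d} {d′} (φ , ψ , ψφ , φψ , φl , φr) (φ′ , ψ′ , ψφ′ , φψ′ , φl′ , φr′) =
    There.map , Back.map ,
    Pushout.jointly-epic c d (round-trip There.map-p₁ Back.map-p₁ ψφ)
                             (round-trip There.map-p₂ Back.map-p₂ ψφ′) ,
    Pushout.jointly-epic c′ d′ (round-trip Back.map-p₁ There.map-p₁ φψ)
                               (round-trip Back.map-p₂ There.map-p₂ φψ′) ,
    There.map-left φl , There.map-right φr′
    where
      module There = CompositeMap {c = c} {c′} {d} {d′} φ φ′ φr φl′
      module Back  = CompositeMap {c = c′} {c} {d′} {d} ψ ψ′ (transpose ψφ φr) (transpose ψφ′ φl′)

      round-trip : ∀ {A B P P′} {u : P ⇒ P′} {v : P′ ⇒ P} {p : A ⇒ P} {p′ : B ⇒ P′}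
                     {x : A ⇒ B} {y : B ⇒ A} →
                   u ∘ p ≈ p′ ∘ x → v ∘ p′ ≈ p ∘ y → y ∘ x ≈ id → (v ∘ u) ∘ p ≈ id ∘ p
      round-trip up vp yx = pullʳ up ⟫ pullˡ vp ⟫ cancelʳ yx ⟫ ≈-sym identityˡ

  -- Composition is associative: the pushout of c ⨾c d and f is, by the
  -- pasting law, the pushout of c and d ⨾c f.
  ⨾-assoc : {c : Cospan W X} {d : Cospan X Y} {f : Cospan Y Z} →
            ((c ⨾c d) ⨾c f) ≅c (c ⨾c (d ⨾c f))
  ⨾-assoc {c = c} {d} {f} =
    ≅c-trans (pushout-square-≅ pasted)
             (≅c-legs (refl⟩∘⟨ Pcd.left-composite ⟫ pullˡ (Pcd.mediate-p₁ a-cocone)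
                       ⟫ ≈-sym R.left-composite)
                      (pullʳ (≈-sym Q.right-composite) ⟫ ≈-sym R.right-composite))
    where
      module Pcd = Pushout c d
      module Q   = Pushout d f
      module R   = Pushout c (d ⨾c f)
      module S   = Pushout (c ⨾c d) f

      a-cocone : R.p₁ ∘ right c ≈ (R.p₂ ∘ Q.p₁) ∘ left d
      a-cocone = R.commutes ⟫ refl⟩∘⟨ Q.left-composite ⟫ sym-assoc

      w-cocone : (S.p₁ ∘ Pcd.p₂) ∘ right d ≈ S.p₂ ∘ left f
      w-cocone = pullʳ (≈-sym Pcd.right-composite) ⟫ S.commutes

      w : Q.P ⇒ S.P
      w = Q.mediate w-cocone

      v-cocone : (S.p₁ ∘ Pcd.p₁) ∘ right c ≈ w ∘ left (d ⨾c f)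
      v-cocone = pullʳ Pcd.commutes ⟫ sym-assoc ⟫ ≈-sym (Q.mediate-p₁ w-cocone) ⟩∘⟨refl
                 ⟫ pullʳ (≈-sym Q.left-composite)

      pasted : PushoutSquare (c ⨾c d) f
      pasted = record
        { E            = R.P
        ; a            = Pcd.mediate a-cocone
        ; b            = R.p₂ ∘ Q.p₂
        ; square       = refl⟩∘⟨ Pcd.right-composite ⟫ pullˡ (Pcd.mediate-p₂ a-cocone)
                         ⟫ pullʳ Q.commutes ⟫ sym-assoc
        ; epic         = λ sa ta → R.jointly-epic
            (agree-via (≈-sym (Pcd.mediate-p₁ a-cocone)) sa)
            (Q.jointly-epic (assoc ⟫ agree-via (≈-sym (Pcd.mediate-p₂ a-cocone)) sa ⟫ sym-assoc)
                            (assoc ⟫ ta ⟫ sym-assoc))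
        ; comparison   = R.mediate v-cocone
        ; comparison-a = Pcd.jointly-epic
            (pullʳ (Pcd.mediate-p₁ a-cocone) ⟫ R.mediate-p₁ v-cocone)
            (pullʳ (Pcd.mediate-p₂ a-cocone) ⟫ pullˡ (R.mediate-p₂ v-cocone)
             ⟫ Q.mediate-p₁ w-cocone)
        ; comparison-b = pullˡ (R.mediate-p₂ v-cocone) ⟫ Q.mediate-p₂ w-cocone
        }

  ⌞_⌟ : Y ⇒ X → Cospan X Y
  ⌞_⌟ {X = X} g = cospan X id g

  ⌜⌝-⨾ : (f : X ⇒ Y) (d : Cospan Y Z) →
         (⌜ f ⌝ ⨾c d) ≅c cospan (apex d) (left d ∘ f) (right d)
  ⌜⌝-⨾ f d = ≅c-trans (pushout-square-≅ square) (≅c-legs ≈-refl identityˡ)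
    where
      square : PushoutSquare ⌜ f ⌝ d
      square = record
        { E = apex d ; a = left d ; b = id
        ; square = identityʳ ⟫ ≈-sym identityˡ
        ; epic = jointly-epic-idʳ
        ; comparison = Pushout.p₂ ⌜ f ⌝ d
        ; comparison-a = ≈-sym (Pushout.commutes ⌜ f ⌝ d) ⟫ identityʳ
        ; comparison-b = identityʳ
        }

  ⨾-⌞⌟ : (c : Cospan X Y) (g : Z ⇒ Y) →
         (c ⨾c ⌞ g ⌟) ≅c cospan (apex c) (left c) (right c ∘ g)
  ⨾-⌞⌟ c g = ≅c-trans (pushout-square-≅ square) (≅c-legs identityˡ ≈-refl)
    where
      square : PushoutSquare c ⌞ g ⌟
      square = record
        { E = apex c ; a = id ; b = right c
        ; square = identityˡ ⟫ ≈-sym identityʳ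
        ; epic = jointly-epic-idˡ
        ; comparison = Pushout.p₁ c ⌞ g ⌟
        ; comparison-a = identityʳ
        ; comparison-b = Pushout.commutes c ⌞ g ⌟ ⟫ identityʳ
        }

  ⨾-⌜iso⌝ : (c : Cospan X Y) (g : Iso Y Z) →
            (c ⨾c ⌜ Iso.to g ⌝) ≅c cospan (apex c) (left c) (right c ∘ Iso.from g)
  ⨾-⌜iso⌝ c g = ≅c-trans (pushout-square-≅ square) (≅c-legs identityˡ identityʳ)
    where
      open Iso g
      square : PushoutSquare c ⌜ to ⌝
      square = record
        { E = apex c ; a = id ; b = right c ∘ from
        ; square = identityˡ ⟫ ≈-sym (cancelʳ isoˡ)
        ; epic = jointly-epic-idˡ
        ; comparison = Pushout.p₁ c ⌜ to ⌝
        ; comparison-a = identityʳ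
        ; comparison-b = sym-assoc ⟫ Pushout.commutes c ⌜ to ⌝ ⟩∘⟨refl ⟫ cancelʳ isoʳ
        }

  ⨾-identityˡ : {c : Cospan X Y} → (idc ⨾c c) ≅c c
  ⨾-identityˡ {c = c} = ≅c-trans (⌜⌝-⨾ id c) (≅c-legs identityʳ ≈-refl)

  ⨾-identityʳ : {c : Cospan X Y} → (c ⨾c idc) ≅c c
  ⨾-identityʳ {c = c} = ≅c-trans (⨾-⌞⌟ c id) (≅c-legs ≈-refl identityʳ)

  ⌜⌝-resp : {f g : X ⇒ Y} → f ≈ g → ⌜ f ⌝ ≅c ⌜ g ⌝
  ⌜⌝-resp p = ≅c-legs p ≈-refl

  ⌞⌟-resp : {f g : Y ⇒ X} → f ≈ g → ⌞ f ⌟ ≅c ⌞ g ⌟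
  ⌞⌟-resp p = ≅c-legs ≈-refl p

  ⌜⌝-∘ : {c : Cospan X Y} {d : Cospan Y Z} {f : X ⇒ Y} {g : Y ⇒ Z} →
         c ≅c ⌜ f ⌝ → d ≅c ⌜ g ⌝ → (c ⨾c d) ≅c ⌜ g ∘ f ⌝
  ⌜⌝-∘ {f = f} {g} p q = ≅c-trans (⨾-resp p q) (⌜⌝-⨾ f ⌜ g ⌝)

  ⌞⌟-∘ : {c : Cospan X Y} {d : Cospan Y Z} {f : Y ⇒ X} {g : Z ⇒ Y} →
         c ≅c ⌞ f ⌟ → d ≅c ⌞ g ⌟ → (c ⨾c d) ≅c ⌞ f ∘ g ⌟
  ⌞⌟-∘ {f = f} {g} p q = ≅c-trans (⨾-resp p q) (⨾-⌞⌟ ⌞ f ⌟ g)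

  ⌞⌟-⨾-⌜iso⌝ : {c : Cospan X Y} {f : Y ⇒ X} → c ≅c ⌞ f ⌟ → (g : Iso Y Z) →
               (c ⨾c ⌜ Iso.to g ⌝) ≅c ⌞ f ∘ Iso.from g ⌟
  ⌞⌟-⨾-⌜iso⌝ {f = f} p g = ≅c-trans (⨾-resp p ≅c-refl) (⨾-⌜iso⌝ ⌞ f ⌟ g)

  ⌜⌝-equation : {c d : Cospan X Y} {f g : X ⇒ Y} → c ≅c ⌜ f ⌝ → d ≅c ⌜ g ⌝ → f ≈ g → c ≅c d
  ⌜⌝-equation p q f≈g = ≅c-trans p (≅c-trans (⌜⌝-resp f≈g) (≅c-sym q))

  ⌞⌟-equation : {c d : Cospan X Y} {f g : Y ⇒ X} → c ≅c ⌞ f ⌟ → d ≅c ⌞ g ⌟ → f ≈ g → c ≅c d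
  ⌞⌟-equation p q f≈g = ≅c-trans p (≅c-trans (⌞⌟-resp f≈g) (≅c-sym q))

  ⌜⌝-inverse : (g : Iso X Y) → (⌜ Iso.to g ⌝ ⨾c ⌜ Iso.from g ⌝) ≅c idc
  ⌜⌝-inverse g = ⌜⌝-equation (⌜⌝-∘ ≅c-refl ≅c-refl) ≅c-refl (Iso.isoˡ g)

  ⊕-resp : {c d : Cospan X Y} {c′ d′ : Cospan X′ Y′} →
           c ≅c d → c′ ≅c d′ → (c ⊕c c′) ≅c (d ⊕c d′)
  ⊕-resp (φ , ψ , ψφ , φψ , φl , φr) (φ′ , ψ′ , ψφ′ , φψ′ , φl′ , φr′) =
    φ +₁ φ′ , ψ +₁ ψ′ ,
    +₁-∘ ⟫ +₁-resp ψφ ψφ′ ⟫ +₁-id , +₁-∘ ⟫ +₁-resp φψ φψ′ ⟫ +₁-id ,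
    +₁-∘ ⟫ +₁-resp φl φl′ , +₁-∘ ⟫ +₁-resp φr φr′

  ⊕-mono : {c d : Cospan X Y} {c′ d′ : Cospan X′ Y′} →
           c ≤c d → c′ ≤c d′ → (c ⊕c c′) ≤c (d ⊕c d′)
  ⊕-mono (h , hl , hr) (h′ , hl′ , hr′) = h +₁ h′ , +₁-∘ ⟫ +₁-resp hl hl′ , +₁-∘ ⟫ +₁-resp hr hr′

  ⊕-id : (idc {X} ⊕c idc {Y}) ≅c idc
  ⊕-id = ≅c-legs +₁-id +₁-id

  ⌜⌝-⊕ : {c : Cospan X Y} {d : Cospan X′ Y′} {f : X ⇒ Y} {g : X′ ⇒ Y′} →
         c ≅c ⌜ f ⌝ → d ≅c ⌜ g ⌝ → (c ⊕c d) ≅c ⌜ f +₁ g ⌝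
  ⌜⌝-⊕ p q = ≅c-trans (⊕-resp p q) (≅c-legs ≈-refl +₁-id)

  ⌞⌟-⊕ : {c : Cospan X Y} {d : Cospan X′ Y′} {f : Y ⇒ X} {g : Y′ ⇒ X′} →
         c ≅c ⌞ f ⌟ → d ≅c ⌞ g ⌟ → (c ⊕c d) ≅c ⌞ f +₁ g ⌟
  ⌞⌟-⊕ p q = ≅c-trans (⊕-resp p q) (≅c-legs +₁-id ≈-refl)

  -- Interchange: the sum of two pushout squares is a pushout square.
  ⊕-⨾ : {c : Cospan X Y} {d : Cospan Y Z} {c′ : Cospan X′ Y′} {d′ : Cospan Y′ Z′} →
        ((c ⨾c d) ⊕c (c′ ⨾c d′)) ≅c ((c ⊕c c′) ⨾c (d ⊕c d′))
  ⊕-⨾ {c = c} {d} {c′} {d′} =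
    ≅c-sym (≅c-trans (pushout-square-≅ summed)
                     (≅c-legs (+₁-∘ ⟫ +₁-resp (≈-sym P.left-composite) (≈-sym P′.left-composite))
                              (+₁-∘ ⟫ +₁-resp (≈-sym P.right-composite)
                                              (≈-sym P′.right-composite))))
    where
      module P  = Pushout c d
      module P′ = Pushout c′ d′
      module Q  = Pushout (c ⊕c c′) (d ⊕c d′)

      on₁ : (Q.p₁ ∘ ι₁) ∘ right c ≈ (Q.p₂ ∘ ι₁) ∘ left d
      on₁ = restrict-ι₁ Q.commutes

      on₂ : (Q.p₁ ∘ ι₂) ∘ right c′ ≈ (Q.p₂ ∘ ι₂) ∘ left d′
      on₂ = restrict-ι₂ Q.commutes

      summed : PushoutSquare (c ⊕c c′) (d ⊕c d′)
      summed = record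
        { E            = P.P + P′.P
        ; a            = P.p₁ +₁ P′.p₁
        ; b            = P.p₂ +₁ P′.p₂
        ; square       = +₁-∘ ⟫ +₁-resp P.commutes P′.commutes ⟫ ≈-sym +₁-∘
        ; epic         = +₁-jointly-epic P.jointly-epic P′.jointly-epic
        ; comparison   = copair (P.mediate on₁) (P′.mediate on₂)
        ; comparison-a = +-ext (pullʳ +₁-ι₁ ⟫ copair-ι₁ ⟫ P.mediate-p₁ on₁)
                               (pullʳ +₁-ι₂ ⟫ copair-ι₂ ⟫ P′.mediate-p₁ on₂)
        ; comparison-b = +-ext (pullʳ +₁-ι₁ ⟫ copair-ι₁ ⟫ P.mediate-p₂ on₁)
                               (pullʳ +₁-ι₂ ⟫ copair-ι₂ ⟫ P′.mediate-p₂ on₂)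
        }

  iso-natural : (c : Cospan X Y) (d : Cospan X′ Y′) (gX : Iso X X′) (gY : Iso Y Y′)
                (φ : Iso (apex c) (apex d)) →
                Iso.to φ ∘ left c ≈ left d ∘ Iso.to gX →
                Iso.to φ ∘ right c ≈ right d ∘ Iso.to gY →
                (c ⨾c ⌜ Iso.to gY ⌝) ≅c (⌜ Iso.to gX ⌝ ⨾c d)
  iso-natural c d gX gY φ φl φr =
    ≅c-trans (⨾-⌜iso⌝ c gY)
      (≅c-trans (Iso.to φ , Iso.from φ , Iso.isoˡ φ , Iso.isoʳ φ , φl ,
                 sym-assoc ⟫ φr ⟩∘⟨refl ⟫ cancelʳ (Iso.isoʳ gY))
                (≅c-sym (⌜⌝-⨾ (Iso.to gX) d)))

  module _ {X : Obj} where
    codiagonal-pushout : {Z : Obj} (k m : Z ⇒ X + X) → ∇ ∘ k ≈ ∇ ∘ m →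
      (∀ {W} {h₁ h₂ : X + X ⇒ W} → h₁ ∘ k ≈ h₂ ∘ m → (h₁ ≈ h₂) × (h₁ ∘ ι₁ ≈ h₁ ∘ ι₂)) →
      (⌞ k ⌟ ⨾c ⌜ m ⌝) ≅c cospan X ∇ ∇
    codiagonal-pushout k m ∇-square constant =
      ≅c-trans (pushout-square-≅ square) (≅c-legs identityʳ identityʳ)
      where
        open Pushout ⌞ k ⌟ ⌜ m ⌝
        p-constant = constant commutes

        collapse : (p₁ ∘ ι₁) ∘ ∇ ≈ p₁
        collapse = +-ext (pullʳ inject₁ ⟫ identityʳ)
                         (pullʳ inject₂ ⟫ identityʳ ⟫ proj₂ p-constant)

        square : PushoutSquare ⌞ k ⌟ ⌜ m ⌝
        square = record
          { E = X ; a = ∇ ; b = ∇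
          ; square = ∇-square
          ; epic = λ s∇≈t∇ _ → split-epic inject₁ s∇≈t∇
          ; comparison = p₁ ∘ ι₁
          ; comparison-a = collapse
          ; comparison-b = collapse ⟫ proj₁ p-constant
          }

    -- (δ ⊕ id) ⨾ α ⨾ (id ⊕ μ), computed as a pushout.
    frobenius-left : (⌞ (∇ +₁ id) ∘ assocC⁻¹ {X} {X} {X} ⌟ ⨾c ⌜ id +₁ ∇ ⌝) ≅c cospan X ∇ ∇
    frobenius-left = codiagonal-pushout _ _
      (+-ext₃′ (meet (assoc ⟫ refl⟩∘⟨ k-ι₁ ⟫ inject₁) (assoc ⟫ refl⟩∘⟨ m-ι₁ ⟫ inject₁))
               (meet (assoc ⟫ refl⟩∘⟨ k-ι₂ι₁ ⟫ inject₁) (assoc ⟫ refl⟩∘⟨ m-ι₂ι₁ ⟫ inject₂))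
               (meet (assoc ⟫ refl⟩∘⟨ k-ι₂ι₂ ⟫ inject₂) (assoc ⟫ refl⟩∘⟨ m-ι₂ι₂ ⟫ inject₂)))
      λ cocone → let on-ι₁   = square-at cocone k-ι₁ m-ι₁
                     on-ι₂ι₁ = square-at cocone k-ι₂ι₁ m-ι₂ι₁
                     on-ι₂ι₂ = square-at cocone k-ι₂ι₂ m-ι₂ι₂
                 in +-ext on-ι₁ on-ι₂ι₂ , on-ι₂ι₁ ⟫ ≈-sym on-ι₂ι₂
      where
        k-ι₁ = assoc ⟫ refl⟩∘⟨ assocC⁻¹-ι₁ ⟫ +₁-ι₁∘ ⟫ refl⟩∘⟨ inject₁ ⟫ identityʳ
        k-ι₂ι₁ = assoc ⟫ refl⟩∘⟨ assocC⁻¹-ι₂ι₁ ⟫ +₁-ι₁∘ ⟫ refl⟩∘⟨ inject₂ ⟫ identityʳ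
        k-ι₂ι₂ = assoc ⟫ refl⟩∘⟨ assocC⁻¹-ι₂ι₂ ⟫ +₁-ι₂ ⟫ identityʳ
        m-ι₁ = +₁-ι₁ ⟫ identityʳ
        m-ι₂ι₁ = +₁-ι₂∘ ⟫ refl⟩∘⟨ inject₁ ⟫ identityʳ
        m-ι₂ι₂ = +₁-ι₂∘ ⟫ refl⟩∘⟨ inject₂ ⟫ identityʳ

    -- (id ⊕ δ) ⨾ α⁻¹ ⨾ (μ ⊕ id), computed as a pushout.
    frobenius-right : (⌞ (id +₁ ∇) ∘ assocC {X} {X} {X} ⌟ ⨾c ⌜ ∇ +₁ id ⌝) ≅c cospan X ∇ ∇
    frobenius-right = codiagonal-pushout _ _
      (+-ext₃ (meet (assoc ⟫ refl⟩∘⟨ k-ι₁ι₁ ⟫ inject₁) (assoc ⟫ refl⟩∘⟨ m-ι₁ι₁ ⟫ inject₁))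
              (meet (assoc ⟫ refl⟩∘⟨ k-ι₁ι₂ ⟫ inject₂) (assoc ⟫ refl⟩∘⟨ m-ι₁ι₂ ⟫ inject₁))
              (meet (assoc ⟫ refl⟩∘⟨ k-ι₂ ⟫ inject₂) (assoc ⟫ refl⟩∘⟨ m-ι₂ ⟫ inject₂)))
      λ cocone → let on-ι₁ι₁ = square-at cocone k-ι₁ι₁ m-ι₁ι₁
                     on-ι₁ι₂ = square-at cocone k-ι₁ι₂ m-ι₁ι₂
                     on-ι₂   = square-at cocone k-ι₂ m-ι₂
                 in +-ext on-ι₁ι₁ on-ι₂ , on-ι₁ι₁ ⟫ ≈-sym on-ι₁ι₂
      where
        k-ι₁ι₁ = assoc ⟫ refl⟩∘⟨ assocC-ι₁ι₁ ⟫ +₁-ι₁ ⟫ identityʳ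
        k-ι₁ι₂ = assoc ⟫ refl⟩∘⟨ assocC-ι₁ι₂ ⟫ +₁-ι₂∘ ⟫ refl⟩∘⟨ inject₁ ⟫ identityʳ
        k-ι₂ = assoc ⟫ refl⟩∘⟨ assocC-ι₂ ⟫ +₁-ι₂∘ ⟫ refl⟩∘⟨ inject₂ ⟫ identityʳ
        m-ι₁ι₁ = +₁-ι₁∘ ⟫ refl⟩∘⟨ inject₁ ⟫ identityʳ
        m-ι₁ι₂ = +₁-ι₁∘ ⟫ refl⟩∘⟨ inject₂ ⟫ identityʳ
        m-ι₂ = +₁-ι₂ ⟫ identityʳ

    μ⨾δ : (⌜ ∇ {X} ⌝ ⨾c ⌞ ∇ ⌟) ≅c cospan X ∇ ∇
    μ⨾δ = ≅c-trans (⌜⌝-⨾ ∇ ⌞ ∇ ⌟) (≅c-legs identityˡ ≈-refl)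

    δ⨾μ : (⌞ ∇ {X} ⌟ ⨾c ⌜ ∇ ⌝) ≅c idc
    δ⨾μ = ≅c-trans (pushout-square-≅ square) (≅c-legs identityˡ identityˡ)
      where
        open Pushout ⌞ ∇ {X} ⌟ ⌜ ∇ ⌝
        square : PushoutSquare ⌞ ∇ {X} ⌟ ⌜ ∇ ⌝
        square = record
          { E = X ; a = id ; b = id
          ; square = ≈-refl
          ; epic = jointly-epic-idˡ
          ; comparison = p₁
          ; comparison-a = identityʳ
          ; comparison-b = identityʳ ⟫ split-epic inject₁ commutes
          }

  frobenius-bimonoid : (X : Obj) → FrobeniusBimonoid CospanLeq X
  frobenius-bimonoid X = record
    { μ = ⌜ ∇ ⌝
    ; η = ⌜ ¡ ⌝
    ; δ = ⌞ ∇ ⌟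
    ; ε = ⌞ ¡ ⌟
    ; μ-assoc  = ⌜⌝-equation (⌜⌝-∘ (⌜⌝-⊕ ≅c-refl ≅c-refl) ≅c-refl)
                             (⌜⌝-∘ (⌜⌝-∘ ≅c-refl (⌜⌝-⊕ ≅c-refl ≅c-refl)) ≅c-refl) ∇-assoc
    ; μ-unitˡ  = ⌜⌝-equation (⌜⌝-∘ (⌜⌝-⊕ ≅c-refl ≅c-refl) ≅c-refl) ≅c-refl ∇-unitˡ
    ; μ-unitʳ  = ⌜⌝-equation (⌜⌝-∘ (⌜⌝-⊕ ≅c-refl ≅c-refl) ≅c-refl) ≅c-refl ∇-unitʳ
    ; μ-comm   = ⌜⌝-equation (⌜⌝-∘ ≅c-refl ≅c-refl) ≅c-refl ∇-comm
    ; δ-assoc  = ⌞⌟-equation (⌞⌟-⨾-⌜iso⌝ (⌞⌟-∘ ≅c-refl (⌞⌟-⊕ ≅c-refl ≅c-refl)) assocC-iso)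
                             (⌞⌟-∘ ≅c-refl (⌞⌟-⊕ ≅c-refl ≅c-refl))
                             (∇-assoc ⟩∘⟨refl ⟫ pullʳ (cancelʳ (Iso.isoʳ assocC-iso)))
    ; δ-unitˡ  = ⌞⌟-equation (⌞⌟-⨾-⌜iso⌝ (⌞⌟-∘ ≅c-refl (⌞⌟-⊕ ≅c-refl ≅c-refl)) λC-iso)
                             ≅c-refl (∇-unitˡ ⟩∘⟨refl ⟫ Iso.isoʳ λC-iso)
    ; δ-unitʳ  = ⌞⌟-equation (⌞⌟-⨾-⌜iso⌝ (⌞⌟-∘ ≅c-refl (⌞⌟-⊕ ≅c-refl ≅c-refl)) ρC-iso)
                             ≅c-refl (∇-unitʳ ⟩∘⟨refl ⟫ Iso.isoʳ ρC-iso)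
    ; δ-comm   = ⌞⌟-equation (⌞⌟-⨾-⌜iso⌝ ≅c-refl σC-iso) ≅c-refl ∇-comm
    ; frobeniusˡ = ≅c-trans (⨾-resp (⌞⌟-⨾-⌜iso⌝ (⌞⌟-⊕ ≅c-refl ≅c-refl) assocC-iso)
                                    (⌜⌝-⊕ ≅c-refl ≅c-refl))
                            (≅c-trans frobenius-left (≅c-sym μ⨾δ))
    ; frobeniusʳ = ≅c-trans (⨾-resp (⌞⌟-⨾-⌜iso⌝ (⌞⌟-⊕ ≅c-refl ≅c-refl) (Iso-sym assocC-iso))
                                    (⌜⌝-⊕ ≅c-refl ≅c-refl))
                            (≅c-trans frobenius-right (≅c-sym μ⨾δ))
    ; special    = δ⨾μ
    -- X with identity legs is a cocone on ε ⨾ η.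
    ; adj-unit₁  = ≤c-trans (≅⇒≤ (≅c-legs (≈-sym identityˡ) (≈-sym identityˡ))) (cocone-≤ ≈-refl)
    ; adj-unit₂  = ¡ , ¡-unique _ _ , ¡-unique _ _
    ; adj-mult₁  = ≅⇒≤ (≅c-sym δ⨾μ)
    ; adj-mult₂  = ≤c-trans (≅⇒≤ μ⨾δ) (∇ , identityʳ , identityʳ)
    }

  lax-δ : (R : Cospan X Y) → (R ⨾c ⌞ ∇ ⌟) ≤c (⌞ ∇ ⌟ ⨾c (R ⊕c R))
  lax-δ R = ≤c-trans (≅⇒≤ (≅c-trans (⨾-⌞⌟ R ∇) (≅c-legs (≈-sym identityʳ) ∇-natural)))
                     (cocone-≤ ∇-natural)

  lax-ε : (R : Cospan X Y) → (R ⨾c ⌞ ¡ ⌟) ≤c ⌞ ¡ ⌟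
  lax-ε R = ≤c-trans (≅⇒≤ (⨾-⌞⌟ R ¡)) (left R , identityʳ , ¡-unique _ _)

mainTheorem5 : ∀ {o ℓ e} (C : Category o ℓ e) (fc : FinitelyCocomplete C) →
    IsPreorderedCartesianBicategory (CospanConstruction.CospanLeq C fc)
mainTheorem5 C fc = record
  { isPreorder = record
      { isEquivalence = record { refl = ≅c-refl ; sym = ≅c-sym ; trans = ≅c-trans }
      ; reflexive     = ≅⇒≤
      ; trans         = ≤c-trans
      }
  ; ⨾-resp-≈  = ⨾-resp
  ; ⨾-mono    = ⨾-mono
  ; assoc     = ⨾-assoc
  ; identityˡ = ⨾-identityˡ
  ; identityʳ = ⨾-identityʳ
  ; ⊕-resp-≈  = ⊕-resp
  ; ⊕-mono    = ⊕-mono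
  ; ⊕-id      = ⊕-id
  ; ⊕-⨾       = ⊕-⨾
  ; α-isoˡ    = ⌜⌝-inverse assocC-iso
  ; α-isoʳ    = ⌜⌝-inverse (Iso-sym assocC-iso)
  ; λ-isoˡ    = ⌜⌝-inverse λC-iso
  ; λ-isoʳ    = ⌜⌝-inverse (Iso-sym λC-iso)
  ; ρ-isoˡ    = ⌜⌝-inverse ρC-iso
  ; ρ-isoʳ    = ⌜⌝-inverse (Iso-sym ρC-iso)
  ; σ-inv     = ⌜⌝-inverse σC-iso
  ; α-natural = iso-natural _ _ assocC-iso assocC-iso assocC-iso assocC-natural assocC-natural
  ; λ-natural = iso-natural _ _ λC-iso λC-iso λC-iso λC-natural λC-natural
  ; ρ-natural = iso-natural _ _ ρC-iso ρC-iso ρC-iso ρC-natural ρC-natural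
  ; σ-natural = iso-natural _ _ σC-iso σC-iso σC-iso σC-natural σC-natural
  ; pentagon  = ⌜⌝-equation (⌜⌝-∘ ≅c-refl ≅c-refl)
                  (⌜⌝-∘ (⌜⌝-∘ (⌜⌝-⊕ ≅c-refl ≅c-refl) ≅c-refl) (⌜⌝-⊕ ≅c-refl ≅c-refl)) pentagonC
  ; triangle  = ⌜⌝-equation (⌜⌝-∘ ≅c-refl (⌜⌝-⊕ ≅c-refl ≅c-refl)) (⌜⌝-⊕ ≅c-refl ≅c-refl) triangleC
  ; hexagon   = ⌜⌝-equation (⌜⌝-∘ (⌜⌝-∘ ≅c-refl ≅c-refl) ≅c-refl)
                  (⌜⌝-∘ (⌜⌝-∘ (⌜⌝-⊕ ≅c-refl ≅c-refl) ≅c-refl) (⌜⌝-⊕ ≅c-refl ≅c-refl)) hexagonC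
  ; frobenius = frobenius-bimonoid
  ; lax-δ     = lax-δ
  ; lax-ε     = lax-ε
  }
  where
    open CategoryReasoning C using (Iso-sym)
    open CoproductCalculus C fc
    open CospanLaws C fc
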